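{- Let $f$ be an EO signature satisfying ARS of arity $2n\geq8$ with $f\in\int\mathcal{B}_{\not\equiv0}$. Suppose there exist two distinct (not necessarily disjoint) pairs of indices $\{s,t\}$ and $\{s',t'\}$ and a binary signature $b(x_u,x_v)$ with $\{u,v\}\cap(\{s,t\}\cup\{s',t'\})=\emptyset$ such that $b(x_u,x_v)\mid\partial_{(st)}f$ and $b(x_u,x_v)\mid\partial_{(s't')}f$. Then for every pair $\{i,j\}$ disjoint from $\{u,v\}\cup\{s,t\}\cup\{s',t'\}$ with $\partial_{(st)}\partial_{(ij)}f\not\equiv0$ and $\partial_{(s't')}\partial_{(ij)}f\not\equiv0$, we have $b(x_u,x_v)\mid\partial_{(ij)}f$.
   Context: A signature of arity $m\ge1$ is a function $\{0,1\}^m\to\mathbb{C}$. A signature of arity $2n$ is EO if its support consists only of inputs of Hamming weight $n$; it satisfies ARS if $f(\bar\alpha)=\overline{f(\alpha)}$ for all $\alpha$ ($\bar\alpha$ = bitwise complement). For distinct indices $i,j$, $f^{ab}_{ij}$ is $f$ with $(x_i,x_j)$ fixed to $(a,b)$, and the merging is $\partial_{(ij)}f=f^{01}_{ij}+f^{10}_{ij}$, a signature on the remaining variables (variables keep their original indices). $\mathcal{B}$ is the set of tensor products (up to permutation of variables) of one or more binary signatures $(f^{00},f^{01},f^{10},f^{11})=(0,a,\bar a,0)$, $a\in\mathbb{C}$. $f\in\int\mathcal{B}_{\not\equiv0}$ means that for every pair $\{i,j\}$, $\partial_{(ij)}f\in\mathcal{B}$ and $\partial_{(ij)}f$ is not identically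 zero. A nonzero signature $g$ divides $f$ ($g\mid f$) if $f=g\otimes h$ for some signature $h$ up to permutation of variables, or $f=\lambda g$ for a constant $\lambda$. -}

module Defs where

open import Data.Nat using (ℕ; zero; suc) renaming (_+_ to _+ℕ_)
open import Data.Bool using (Bool; true; false; _∧_; _∨_; not)
open import Data.Fin using (Fin; _≟_)
open import Data.Vec using (Vec; []; _∷_; lookup; _[_]≔_; map)
open import Data.List using (List; []; _∷_)
open import Data.List.Relation.Unary.Any using (Any)
open import Data.Product using (Σ; _×_; _,_; ∃; proj₁; proj₂)
open import Data.Sum using (_⊎_)
open import Relation.Binary.PropositionalEquality using (_≡_; _≢_)
open import Relation.Nullary using (¬_)
open import Relation.Nullary.Decidable using (⌊_⌋)
open import Algebra.Structures using (IsCommutativeRing)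
open import Relation.Binary.Structures using (IsTotalOrder)

-- Ordered fields (propositional equality).  The complex numbers are
-- modelled as R(i) = R × R for an ordered field R.

record OrderedField : Set₁ where
  infixl 7 _*_
  infixl 6 _+_
  field
    R      : Set
    0# 1#  : R
    _+_ _*_ : R → R → R
    -_     : R → R
    _⁻¹    : R → R
    _≤_    : R → R → Set
    isCommutativeRing : IsCommutativeRing _≡_ _+_ _*_ -_ 0# 1#
    0≢1    : 0# ≢ 1#
    ⁻¹-inverse : ∀ x → x ≢ 0# → x * (x ⁻¹) ≡ 1#
    isTotalOrder : IsTotalOrder _≡_ _≤_
    +-mono-≤ : ∀ {a b} c → a ≤ b → (a + c) ≤ (b + c)
    *-nonneg : ∀ {a b} → 0# ≤ a → 0# ≤ b → 0# ≤ (a * b)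

module _ (F : OrderedField) where
  open OrderedField F

  ℂ : Set
  ℂ = R × R

  0ℂ : ℂ
  0ℂ = 0# , 0#

  1ℂ : ℂ
  1ℂ = 1# , 0#

  _+ℂ_ : ℂ → ℂ → ℂ
  (a , b) +ℂ (c , d) = (a + c) , (b + d)

  _*ℂ_ : ℂ → ℂ → ℂ
  (a , b) *ℂ (c , d) = ((a * c) + (- (b * d))) , ((a * d) + (b * c))

  conj : ℂ → ℂ
  conj (a , b) = a , (- b)

  -- Signatures whose variables are named by indices in Fin N.
  -- 'scope' says which variables the signature depends on; 'val' is
  -- evaluated on a full assignment of all N variables.

  record Sig (N : ℕ) : Set where
    field
      scope : Fin N → Bool
      val   : Vec Bool N → ℂ

  open Sig public

  Local : ∀ {N} → Sig N → Set
  Local {N} g = ∀ (x y : Vec Bool N) →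
    (∀ k → scope g k ≡ true → lookup x k ≡ lookup y k) → val g x ≡ val g y

  NotZero : ∀ {N} → Sig N → Set
  NotZero g = ¬ (∀ x → val g x ≡ 0ℂ)

  full : ∀ {N} → (Vec Bool N → ℂ) → Sig N
  full f = record { scope = λ _ → true ; val = f }

  binSig : ∀ {N} → Fin N → Fin N → (Bool → Bool → ℂ) → Sig N
  binSig u v b = record
    { scope = λ k → ⌊ k ≟ u ⌋ ∨ ⌊ k ≟ v ⌋
    ; val   = λ x → b (lookup x u) (lookup x v) }

  merge : ∀ {N} → Fin N → Fin N → Sig N → Sig N
  merge i j g = record
    { scope = λ k → scope g k ∧ not ⌊ k ≟ i ⌋ ∧ not ⌊ k ≟ j ⌋
    ; val   = λ x → val g ((x [ i ]≔ false) [ j ]≔ true)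
                +ℂ val g ((x [ i ]≔ true) [ j ]≔ false) }

  Divides : ∀ {N} → Sig N → Sig N → Set
  Divides {N} g f = NotZero g ×
    ( (Σ (Sig N) λ h → Local h
        × (∀ k → scope g k ∧ scope h k ≡ false)
        × (∀ k → scope f k ≡ (scope g k ∨ scope h k))
        × (∃ λ k → scope h k ≡ true)
        × (∀ x → val f x ≡ (val g x *ℂ val h x)))
    ⊎ (Σ ℂ λ c → (∀ k → scope f k ≡ scope g k)
        × (∀ x → val f x ≡ (c *ℂ val g x))) )

  arsBin : ℂ → Bool → Bool → ℂ
  arsBin a false true = a
  arsBin a true false = conj a
  arsBin a _    _     = 0ℂ

  prodB : ∀ {N} → List (Fin N × Fin N × ℂ) → Vec Bool N → ℂ
  prodB []                  x = 1ℂ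
  prodB ((p , q , a) ∷ L)   x = arsBin a (lookup x p) (lookup x q) *ℂ prodB L x

  varsB : ∀ {N} → List (Fin N × Fin N × ℂ) → List (Fin N)
  varsB []                = []
  varsB ((p , q , a) ∷ L) = p ∷ q ∷ varsB L

  data Distinct {A : Set} : List A → Set where
    []  : Distinct []
    _∷_ : ∀ {a L} → ¬ Any (a ≡_) L → Distinct L → Distinct (a ∷ L)

  InB : ∀ {N} → Sig N → Set
  InB {N} g = Σ (List (Fin N × Fin N × ℂ)) λ L →
      (L ≢ [])
    × Distinct (varsB L)
    × (∀ k → (scope g k ≡ true → Any (k ≡_) (varsB L))
           × (Any (k ≡_) (varsB L) → scope g k ≡ true))
    × (∀ x → val g x ≡ prodB L x)

  IntB≢0 : ∀ {N} → Sig N → Set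
  IntB≢0 {N} f = ∀ (i j : Fin N) → i ≢ j → InB (merge i j f) × NotZero (merge i j f)

SamePair : ∀ {N} → Fin N → Fin N → Fin N → Fin N → Set
SamePair a b c d = (a ≡ c × b ≡ d) ⊎ (a ≡ d × b ≡ c)

NotIn2 : ∀ {N} → Fin N → Fin N → Fin N → Set
NotIn2 k a b = k ≢ a × k ≢ b

weight : ∀ {N} → Vec Bool N → ℕ
weight []          = 0
weight (true ∷ x)  = suc (weight x)
weight (false ∷ x) = weight x

module _ (F : OrderedField) where
  open OrderedField F

  EO : (n : ℕ) → (Vec Bool (n +ℕ n) → ℂ F) → Set
  EO n f = ∀ x → weight x ≢ n → f x ≡ 0ℂ F

  ARS : ∀ {N} → (Vec Bool N → ℂ F) → Set
  ARS f = ∀ x → f (map not x) ≡ conj F (f x)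

module Submission where

-- Write g = ∂_(ij) f as a product of binary factors (0, a, ā, 0) on disjoint pairs of variables and let
-- p be the partner of x_u in it.  A function cannot carry binary factors on x_u with two different
-- partners when one of them is a pairing, i.e. vanishes exactly on the diagonal ('partner-unique').
-- Merging commutes, so ∂_(st) g = ∂_(ij) ∂_(st) f carries the factor b(x_u, x_v).  If p = v, comparing
-- the two factorisations of ∂_(st) g at a point where it is nonzero shows that the factor of g on
-- (x_u, x_v) is a multiple of b.  Otherwise the pairing of x_u with p survives in ∂_(st) g unless
-- p ∈ {s, t}; so p ∈ {s, t}, likewise the partner q ≠ p of x_v lies in {s, t}, and the same holds
-- for {s', t'}, forcing {s, t} = {p, q} = {s', t'}.

open import Defs
open import Data.Nat using (ℕ; _≤_) renaming (_+_ to _+ℕ_)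
open import Data.Bool using (Bool; true; false; _∧_; _∨_; not)
open import Data.Bool.Properties using (∧-identityʳ; ∧-zeroʳ)
open import Data.Fin using (Fin; _≟_)
open import Data.Vec using (Vec; lookup; _[_]≔_; replicate)
open import Data.Vec.Properties using (lookup∘update; lookup∘update′; []≔-commutes)
open import Data.List using (List; []; _∷_)
open import Data.List.Membership.Propositional using (_∈_; _∉_)
open import Data.List.Relation.Unary.Any using (here; there)
open import Data.List.Relation.Unary.All using (All; []; _∷_)
open import Data.Product using (Σ-syntax; _×_; _,_; proj₁; proj₂)
open import Data.Sum using (_⊎_; inj₁; inj₂; [_,_]′; map₂)
open import Data.Empty using (⊥-elim)
open import Function using (flip; _∘_)
open import Relation.Binary.PropositionalEquality
open import Relation.Nullary using (¬_; yes; no)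
open import Algebra.Bundles using (CommutativeRing)
open import Relation.Binary.Structures using (IsTotalOrder)
import Algebra.Properties.CommutativeSemigroup as CommutativeSemigroupProperties
import Algebra.Properties.Ring as RingProperties

module ComplexField (F : OrderedField) where
  open OrderedField F renaming (_≤_ to _≤R_)

  commutativeRing : CommutativeRing _ _
  commutativeRing = record { isCommutativeRing = isCommutativeRing }

  open CommutativeRing commutativeRing
    using ( +-comm; +-identityˡ; +-identityʳ; -‿inverseˡ; -‿inverseʳ
          ; *-assoc; *-comm; *-identityˡ; *-identityʳ; zeroˡ; distribˡ; distribʳ
          ; ring; +-commutativeSemigroup )
  open RingProperties ring using (-‿distribˡ-*; -‿distribʳ-*; -‿involutive; -0#≈0#; -‿+-comm)
  open CommutativeSemigroupProperties +-commutativeSemigroup using (interchange)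
  open IsTotalOrder isTotalOrder using (total; antisym)
  open ≡-Reasoning

  -‿distrib-+ : ∀ x y → - (x + y) ≡ - x + - y
  -‿distrib-+ x y = sym (-‿+-comm x y)

  C : Set
  C = ℂ F

  infixl 7 _⊛_
  infixl 6 _⊕_

  _⊛_ : C → C → C
  _⊛_ = _*ℂ_ F

  _⊕_ : C → C → C
  _⊕_ = _+ℂ_ F

  0C 1C : C
  0C = 0ℂ F
  1C = 1ℂ F

  ⊛-comm : ∀ z w → z ⊛ w ≡ w ⊛ z
  ⊛-comm (a , b) (c , d) = cong₂ _,_
    (cong₂ (λ x y → x + - y) (*-comm a c) (*-comm b d))
    (trans (cong₂ _+_ (*-comm a d) (*-comm b c)) (+-comm (d * a) (c * b)))

  ⊛-assoc : ∀ z w y → (z ⊛ w) ⊛ y ≡ z ⊛ (w ⊛ y)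
  ⊛-assoc (a , b) (c , d) (e , f) = cong₂ _,_ re im
    where
    re : (a * c + - (b * d)) * e + - ((a * d + b * c) * f)
       ≡ a * (c * e + - (d * f)) + - (b * (c * f + d * e))
    re = begin
      (a * c + - (b * d)) * e + - ((a * d + b * c) * f)
        ≡⟨ cong₂ (λ x y → x + - y) (distribʳ e (a * c) (- (b * d))) (distribʳ f (a * d) (b * c)) ⟩
      ((a * c) * e + (- (b * d)) * e) + - ((a * d) * f + (b * c) * f)
        ≡⟨ cong₂ (λ x y → ((a * c) * e + x) + y) (sym (-‿distribˡ-* (b * d) e)) (-‿distrib-+ _ _) ⟩
      ((a * c) * e + - ((b * d) * e)) + (- ((a * d) * f) + - ((b * c) * f))
        ≡⟨ interchange _ _ _ _ ⟩
      ((a * c) * e + - ((a * d) * f)) + (- ((b * d) * e) + - ((b * c) * f))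
        ≡⟨ cong (((a * c) * e + - ((a * d) * f)) +_) (+-comm _ _) ⟩
      ((a * c) * e + - ((a * d) * f)) + (- ((b * c) * f) + - ((b * d) * e))
        ≡⟨ cong₂ _+_ (cong₂ (λ x y → x + - y) (*-assoc a c e) (*-assoc a d f))
                     (cong₂ (λ x y → - x + - y) (*-assoc b c f) (*-assoc b d e)) ⟩
      (a * (c * e) + - (a * (d * f))) + (- (b * (c * f)) + - (b * (d * e)))
        ≡⟨ cong₂ _+_ (cong (a * (c * e) +_) (-‿distribʳ-* a (d * f))) (sym (-‿distrib-+ _ _)) ⟩
      (a * (c * e) + a * - (d * f)) + - (b * (c * f) + b * (d * e))
        ≡⟨ sym (cong₂ (λ x y → x + - y) (distribˡ a (c * e) (- (d * f))) (distribˡ b (c * f) (d * e))) ⟩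
      a * (c * e + - (d * f)) + - (b * (c * f + d * e)) ∎
    im : (a * c + - (b * d)) * f + (a * d + b * c) * e
       ≡ a * (c * f + d * e) + b * (c * e + - (d * f))
    im = begin
      (a * c + - (b * d)) * f + (a * d + b * c) * e
        ≡⟨ cong₂ _+_ (distribʳ f (a * c) (- (b * d))) (distribʳ e (a * d) (b * c)) ⟩
      ((a * c) * f + (- (b * d)) * f) + ((a * d) * e + (b * c) * e)
        ≡⟨ cong (λ x → ((a * c) * f + x) + ((a * d) * e + (b * c) * e)) (sym (-‿distribˡ-* (b * d) f)) ⟩
      ((a * c) * f + - ((b * d) * f)) + ((a * d) * e + (b * c) * e)
        ≡⟨ interchange _ _ _ _ ⟩
      ((a * c) * f + (a * d) * e) + (- ((b * d) * f) + (b * c) * e)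
        ≡⟨ cong (((a * c) * f + (a * d) * e) +_) (+-comm _ _) ⟩
      ((a * c) * f + (a * d) * e) + ((b * c) * e + - ((b * d) * f))
        ≡⟨ cong₂ _+_ (cong₂ _+_ (*-assoc a c f) (*-assoc a d e))
                     (cong₂ (λ x y → x + - y) (*-assoc b c e) (*-assoc b d f)) ⟩
      (a * (c * f) + a * (d * e)) + (b * (c * e) + - (b * (d * f)))
        ≡⟨ cong (λ x → (a * (c * f) + a * (d * e)) + (b * (c * e) + x)) (-‿distribʳ-* b (d * f)) ⟩
      (a * (c * f) + a * (d * e)) + (b * (c * e) + b * - (d * f))
        ≡⟨ sym (cong₂ _+_ (distribˡ a (c * f) (d * e)) (distribˡ b (c * e) (- (d * f)))) ⟩
      a * (c * f + d * e) + b * (c * e + - (d * f)) ∎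

  ⊛-distribˡ : ∀ z w y → z ⊛ (w ⊕ y) ≡ z ⊛ w ⊕ z ⊛ y
  ⊛-distribˡ (a , b) (c , d) (e , f) = cong₂ _,_
    (begin
      a * (c + e) + - (b * (d + f))           ≡⟨ cong₂ (λ x y → x + - y) (distribˡ a c e) (distribˡ b d f) ⟩
      (a * c + a * e) + - (b * d + b * f)     ≡⟨ cong ((a * c + a * e) +_) (-‿distrib-+ _ _) ⟩
      (a * c + a * e) + (- (b * d) + - (b * f)) ≡⟨ interchange _ _ _ _ ⟩
      (a * c + - (b * d)) + (a * e + - (b * f)) ∎)
    (begin
      a * (d + f) + b * (c + e)             ≡⟨ cong₂ _+_ (distribˡ a d f) (distribˡ b c e) ⟩
      (a * d + a * f) + (b * c + b * e)     ≡⟨ interchange _ _ _ _ ⟩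
      (a * d + b * c) + (a * f + b * e)     ∎)

  ⊛-distribʳ : ∀ z w y → (w ⊕ y) ⊛ z ≡ w ⊛ z ⊕ y ⊛ z
  ⊛-distribʳ z w y = trans (⊛-comm (w ⊕ y) z) (trans (⊛-distribˡ z w y) (cong₂ _⊕_ (⊛-comm z w) (⊛-comm z y)))

  ⊕-interchange : ∀ z w y x → (z ⊕ w) ⊕ (y ⊕ x) ≡ (z ⊕ y) ⊕ (w ⊕ x)
  ⊕-interchange (a , b) (c , d) (e , f) (g , h) = cong₂ _,_ (interchange a c e g) (interchange b d f h)

  ⊕-identityʳ : ∀ z → z ⊕ 0C ≡ z
  ⊕-identityʳ (a , b) = cong₂ _,_ (+-identityʳ a) (+-identityʳ b)

  ⊛-zeroˡ : ∀ z → 0C ⊛ z ≡ 0C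
  ⊛-zeroˡ (c , d) = cong₂ _,_
    (trans (cong₂ (λ x y → x + - y) (zeroˡ c) (zeroˡ d)) (trans (+-identityˡ (- 0#)) -0#≈0#))
    (trans (cong₂ _+_ (zeroˡ d) (zeroˡ c)) (+-identityˡ 0#))

  ⊛-zeroʳ : ∀ z → z ⊛ 0C ≡ 0C
  ⊛-zeroʳ z = trans (⊛-comm z 0C) (⊛-zeroˡ z)

  ⊛-identityˡ : ∀ z → 1C ⊛ z ≡ z
  ⊛-identityˡ (c , d) = cong₂ _,_
    (trans (cong₂ (λ x y → x + - y) (*-identityˡ c) (zeroˡ d)) (trans (cong (c +_) -0#≈0#) (+-identityʳ c)))
    (trans (cong₂ _+_ (*-identityˡ d) (zeroˡ c)) (+-identityʳ d))

  ⊛-identityʳ : ∀ z → z ⊛ 1C ≡ z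
  ⊛-identityʳ z = trans (⊛-comm z 1C) (⊛-identityˡ z)

  ⊛-lcomm : ∀ z w y → z ⊛ (w ⊛ y) ≡ w ⊛ (z ⊛ y)
  ⊛-lcomm z w y = trans (sym (⊛-assoc z w y)) (trans (cong (_⊛ y) (⊛-comm z w)) (⊛-assoc w z y))

  1C≢0C : 1C ≢ 0C
  1C≢0C e = 0≢1 (sym (cong proj₁ e))

  conj-0 : conj F 0C ≡ 0C
  conj-0 = cong (0# ,_) -0#≈0#

  conj-≢0 : ∀ z → z ≢ 0C → conj F z ≢ 0C
  conj-≢0 (a , b) z≢0 e =
    z≢0 (cong₂ _,_ (cong proj₁ e) (trans (sym (-‿involutive b)) (trans (cong -_ (cong proj₂ e)) -0#≈0#)))

  x*x≥0 : ∀ x → 0# ≤R (x * x)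
  x*x≥0 x with total 0# x
  ... | inj₁ 0≤x = *-nonneg 0≤x 0≤x
  ... | inj₂ x≤0 = subst (0# ≤R_) -x*-x≡x*x (*-nonneg 0≤-x 0≤-x)
    where
    0≤-x : 0# ≤R (- x)
    0≤-x = subst₂ _≤R_ (-‿inverseʳ x) (+-identityˡ (- x)) (+-mono-≤ (- x) x≤0)
    -x*-x≡x*x : (- x) * (- x) ≡ x * x
    -x*-x≡x*x = trans (sym (-‿distribˡ-* x (- x)))
                  (trans (cong -_ (sym (-‿distribʳ-* x x))) (-‿involutive (x * x)))

  x≥0∧y≥0∧x+y≡0⇒x≡0 : ∀ {x y} → 0# ≤R x → 0# ≤R y → x + y ≡ 0# → x ≡ 0#
  x≥0∧y≥0∧x+y≡0⇒x≡0 {x} {y} 0≤x 0≤y x+y≡0 =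
    antisym (subst₂ _≤R_ (+-identityˡ x) (trans (+-comm y x) x+y≡0) (+-mono-≤ x 0≤y)) 0≤x

  x≢0⇒x*x≢0 : ∀ {x} → x ≢ 0# → x * x ≢ 0#
  x≢0⇒x*x≢0 {x} x≢0 x*x≡0 = x≢0 (begin
    x                 ≡⟨ sym (*-identityʳ x) ⟩
    x * 1#            ≡⟨ cong (x *_) (sym (⁻¹-inverse x x≢0)) ⟩
    x * (x * x ⁻¹)    ≡⟨ sym (*-assoc x x (x ⁻¹)) ⟩
    (x * x) * x ⁻¹    ≡⟨ cong (_* x ⁻¹) x*x≡0 ⟩
    0# * x ⁻¹         ≡⟨ zeroˡ _ ⟩
    0#                ∎)

  ⊛-inverse : ∀ z → z ≢ 0C → Σ[ z′ ∈ C ] z ⊛ z′ ≡ 1C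
  ⊛-inverse (a , b) z≢0 = (a * m , - (b * m)) , cong₂ _,_ re im
    where
    norm = a * a + b * b
    m = norm ⁻¹
    norm≢0 : norm ≢ 0#
    norm≢0 norm≡0 = x≢0⇒x*x≢0 (λ a≡0 → x≢0⇒x*x≢0 (λ b≡0 → z≢0 (cong₂ _,_ a≡0 b≡0)) bb≡0) aa≡0
      where
      aa≡0 = x≥0∧y≥0∧x+y≡0⇒x≡0 (x*x≥0 a) (x*x≥0 b) norm≡0
      bb≡0 = x≥0∧y≥0∧x+y≡0⇒x≡0 (x*x≥0 b) (x*x≥0 a) (trans (+-comm (b * b) (a * a)) norm≡0)
    re : a * (a * m) + - (b * - (b * m)) ≡ 1#
    re = begin
      a * (a * m) + - (b * - (b * m))   ≡⟨ cong (λ x → a * (a * m) + - x) (sym (-‿distribʳ-* b (b * m))) ⟩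
      a * (a * m) + - - (b * (b * m))   ≡⟨ cong (a * (a * m) +_) (-‿involutive _) ⟩
      a * (a * m) + b * (b * m)         ≡⟨ sym (cong₂ _+_ (*-assoc a a m) (*-assoc b b m)) ⟩
      (a * a) * m + (b * b) * m         ≡⟨ sym (distribʳ m (a * a) (b * b)) ⟩
      norm * m                          ≡⟨ ⁻¹-inverse norm norm≢0 ⟩
      1#                                ∎
    im : a * - (b * m) + b * (a * m) ≡ 0#
    im = begin
      a * - (b * m) + b * (a * m)       ≡⟨ cong₂ _+_ (sym (-‿distribʳ-* a (b * m))) (sym (*-assoc b a m)) ⟩
      - (a * (b * m)) + (b * a) * m     ≡⟨ cong₂ (λ x y → - x + y * m) (sym (*-assoc a b m)) (*-comm b a) ⟩
      - ((a * b) * m) + (a * b) * m     ≡⟨ -‿inverseˡ _ ⟩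
      0#                                ∎

  ⊛-≡0-cancelˡ : ∀ {z w} → z ≢ 0C → z ⊛ w ≡ 0C → w ≡ 0C
  ⊛-≡0-cancelˡ {z} {w} z≢0 zw≡0 with ⊛-inverse z z≢0
  ... | z′ , zz′≡1 = begin
    w             ≡⟨ sym (⊛-identityˡ w) ⟩
    1C ⊛ w        ≡⟨ cong (_⊛ w) (sym (trans (⊛-comm z′ z) zz′≡1)) ⟩
    (z′ ⊛ z) ⊛ w  ≡⟨ ⊛-assoc z′ z w ⟩
    z′ ⊛ (z ⊛ w)  ≡⟨ cong (z′ ⊛_) zw≡0 ⟩
    z′ ⊛ 0C       ≡⟨ ⊛-zeroʳ z′ ⟩
    0C            ∎

  ⊛-≢0 : ∀ {z w} → z ≢ 0C → w ≢ 0C → z ⊛ w ≢ 0C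
  ⊛-≢0 z≢0 w≢0 zw≡0 = w≢0 (⊛-≡0-cancelˡ z≢0 zw≡0)

  ⊛-≢0ˡ : ∀ {z w} → z ⊛ w ≢ 0C → z ≢ 0C
  ⊛-≢0ˡ {w = w} zw≢0 refl = zw≢0 (⊛-zeroˡ w)

  ⊛-≢0ʳ : ∀ {z w} → z ⊛ w ≢ 0C → w ≢ 0C
  ⊛-≢0ʳ {z} zw≢0 refl = zw≢0 (⊛-zeroʳ z)

module Signatures (F : OrderedField) {N : ℕ} where
  open ComplexField F

  Input : Set
  Input = Vec Bool N

  -- Merging acts on values only: val (merge s t g) is definitionally ∂ s t (val g).
  ∂ : Fin N → Fin N → (Input → C) → Input → C
  ∂ s t φ = val (merge F s t (full F φ))

  Ignores : (Input → C) → Fin N → Set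
  Ignores φ w = ∀ x c → φ (x [ w ]≔ c) ≡ φ x

  lookup-update₂ : ∀ {w s t} (x : Input) a b → w ≢ s → w ≢ t → lookup ((x [ s ]≔ a) [ t ]≔ b) w ≡ lookup x w
  lookup-update₂ x a b w≢s w≢t = trans (lookup∘update′ w≢t (x [ _ ]≔ a) b) (lookup∘update′ w≢s x a)

  update-commutes₂ : ∀ {w s t} (x : Input) a b c → w ≢ s → w ≢ t →
    ((x [ w ]≔ c) [ s ]≔ a) [ t ]≔ b ≡ ((x [ s ]≔ a) [ t ]≔ b) [ w ]≔ c
  update-commutes₂ {w} {s} {t} x a b c w≢s w≢t =
    trans (cong (_[ t ]≔ b) ([]≔-commutes x w s w≢s)) ([]≔-commutes (x [ s ]≔ a) w t w≢t)

  ∂-cong : ∀ {φ ψ} s t → φ ≗ ψ → ∂ s t φ ≗ ∂ s t ψ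
  ∂-cong s t φ≗ψ x = cong₂ _⊕_ (φ≗ψ _) (φ≗ψ _)

  ∂-ignores : ∀ {φ w s t} → w ≢ s → w ≢ t → Ignores φ w → Ignores (∂ s t φ) w
  ∂-ignores {φ} {w} {s} {t} w≢s w≢t φ-ignores x c = cong₂ _⊕_
    (trans (cong φ (update-commutes₂ x false true c w≢s w≢t)) (φ-ignores _ c))
    (trans (cong φ (update-commutes₂ x true false c w≢s w≢t)) (φ-ignores _ c))

  ∂-comm : ∀ φ {i j s t} → i ≢ s → i ≢ t → j ≢ s → j ≢ t → ∂ s t (∂ i j φ) ≗ ∂ i j (∂ s t φ)
  ∂-comm φ {i} {j} {s} {t} i≢s i≢t j≢s j≢t x = trans (⊕-interchange _ _ _ _)
    (cong₂ _⊕_ (cong₂ _⊕_ (swap false true false true) (swap true false false true))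
               (cong₂ _⊕_ (swap false true true false) (swap true false true false)))
    where
    swap : ∀ a b c d → φ ((((x [ s ]≔ a) [ t ]≔ b) [ i ]≔ c) [ j ]≔ d)
                     ≡ φ ((((x [ i ]≔ c) [ j ]≔ d) [ s ]≔ a) [ t ]≔ b)
    swap a b c d = cong φ (trans (cong (_[ j ]≔ d) (sym (update-commutes₂ x a b c i≢s i≢t)))
                                 (sym (update-commutes₂ (x [ i ]≔ c) a b d j≢s j≢t)))

  record BinaryFactor (φ : Input → C) (B : Bool → Bool → C) (w r : Fin N) : Set where
    field
      cofactor   : Input → C
      factorises : ∀ x → φ x ≡ B (lookup x w) (lookup x r) ⊛ cofactor x
      ignores₁   : Ignores cofactor w
      ignores₂   : Ignores cofactor r

  open BinaryFactor

  BinaryFactor-resp-≗ : ∀ {φ ψ B w r} → φ ≗ ψ → BinaryFactor ψ B w r → BinaryFactor φ B w r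
  BinaryFactor-resp-≗ φ≗ψ fac = record
    { cofactor = cofactor fac ; factorises = λ x → trans (φ≗ψ x) (factorises fac x)
    ; ignores₁ = ignores₁ fac ; ignores₂ = ignores₂ fac }

  BinaryFactor-flip : ∀ {φ B w r} → BinaryFactor φ B w r → BinaryFactor φ (flip B) r w
  BinaryFactor-flip fac = record
    { cofactor = cofactor fac ; factorises = factorises fac
    ; ignores₁ = ignores₂ fac ; ignores₂ = ignores₁ fac }

  ∂-BinaryFactor : ∀ {φ B w r s t} → w ≢ s → w ≢ t → r ≢ s → r ≢ t →
    BinaryFactor φ B w r → BinaryFactor (∂ s t φ) B w r
  ∂-BinaryFactor {φ} {B} {w} {r} {s} {t} w≢s w≢t r≢s r≢t fac = record
    { cofactor   = ∂ s t (cofactor fac)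
    ; factorises = λ x → trans (cong₂ _⊕_ (pull x false true) (pull x true false))
                               (sym (⊛-distribˡ (B (lookup x w) (lookup x r)) _ _))
    ; ignores₁   = ∂-ignores w≢s w≢t (ignores₁ fac)
    ; ignores₂   = ∂-ignores r≢s r≢t (ignores₂ fac) }
    where
    pull : ∀ x a b → φ ((x [ s ]≔ a) [ t ]≔ b)
                   ≡ B (lookup x w) (lookup x r) ⊛ cofactor fac ((x [ s ]≔ a) [ t ]≔ b)
    pull x a b = trans (factorises fac _)
      (cong₂ (λ c d → B c d ⊛ cofactor fac ((x [ s ]≔ a) [ t ]≔ b))
             (lookup-update₂ x a b w≢s w≢t) (lookup-update₂ x a b r≢s r≢t))

  BinaryFactor-at : ∀ {φ B w r} → w ≢ r → (fac : BinaryFactor φ B w r) →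
    ∀ x c d → φ ((x [ w ]≔ c) [ r ]≔ d) ≡ B c d ⊛ cofactor fac x
  BinaryFactor-at {φ} {B} {w} {r} w≢r fac x c d = trans (factorises fac y)
    (cong₂ _⊛_ (cong₂ B (trans (lookup∘update′ w≢r (x [ w ]≔ c) d) (lookup∘update w x c))
                        (lookup∘update r (x [ w ]≔ c) d))
               (trans (ignores₂ fac (x [ w ]≔ c) d) (ignores₁ fac x c)))
    where
    y = (x [ w ]≔ c) [ r ]≔ d

  ∂-BinaryFactor-on-pair : ∀ {φ A s t} → s ≢ t → (fac : BinaryFactor φ A s t) →
    ∀ x → ∂ s t φ x ≡ (A false true ⊕ A true false) ⊛ cofactor fac x
  ∂-BinaryFactor-on-pair s≢t fac x =
    trans (cong₂ _⊕_ (BinaryFactor-at s≢t fac x false true) (BinaryFactor-at s≢t fac x true false))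
          (sym (⊛-distribʳ _ _ _))

  -- Abstracts the nonzero factors (0, a, ā, 0) of 𝓑, in either orientation.
  record Pairing (A : Bool → Bool → C) : Set where
    field
      diagonal     : ∀ c → A c c ≡ 0C
      off-diagonal : ∀ c → A (not c) c ≢ 0C

  open Pairing

  Pairing-flip : ∀ {A} → Pairing A → Pairing (flip A)
  Pairing-flip pairing = record
    { diagonal     = diagonal pairing
    ; off-diagonal = λ { false → off-diagonal pairing true ; true → off-diagonal pairing false } }

  cofactor-≢0 : ∀ {φ B w r} (fac : BinaryFactor φ B w r) x → φ x ≢ 0C → cofactor fac x ≢ 0C
  cofactor-≢0 fac x φx≢0 = ⊛-≢0ʳ (subst (_≢ 0C) (factorises fac x) φx≢0)

  factor-≢0 : ∀ {φ B w r} (fac : BinaryFactor φ B w r) x → φ x ≢ 0C → B (lookup x w) (lookup x r) ≢ 0C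
  factor-≢0 fac x φx≢0 = ⊛-≢0ˡ (subst (_≢ 0C) (factorises fac x) φx≢0)

  partner-unique : ∀ {G A B w r r′} → BinaryFactor G A w r → Pairing A → BinaryFactor G B w r′ →
    w ≢ r → (x₀ : Input) → G x₀ ≢ 0C → r ≡ r′
  partner-unique {G} {A} {B} {w} {r} {r′} facA pairing facB w≢r x₀ Gx₀≢0 with r ≟ r′
  ... | yes r≡r′ = r≡r′
  -- Setting x_r := x_w kills the A-factor, hence the B-cofactor, which ignores x_w; flipping x_w then
  -- kills G again although the A-factor has become nonzero.
  ... | no r≢r′ = ⊥-elim (⊛-≢0 (off-diagonal pairing c) (cofactor-≢0 facA x₀ Gx₀≢0) Gx₂≡0)
    where
    c = lookup x₀ w
    x₁ = x₀ [ r ]≔ c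
    Gx₁≡0 : G x₁ ≡ 0C
    Gx₁≡0 = trans (factorises facA x₁)
      (trans (cong₂ (λ a b → A a b ⊛ cofactor facA x₁) (lookup∘update′ w≢r x₀ c) (lookup∘update r x₀ c))
             (trans (cong (_⊛ cofactor facA x₁) (diagonal pairing c)) (⊛-zeroˡ _)))
    Hx₁≡0 : cofactor facB x₁ ≡ 0C
    Hx₁≡0 = ⊛-≡0-cancelˡ (factor-≢0 facB x₀ Gx₀≢0) (begin
      B c (lookup x₀ r′) ⊛ cofactor facB x₁
        ≡⟨ cong₂ (λ a b → B a b ⊛ cofactor facB x₁) (lookup∘update′ w≢r x₀ c)
                 (lookup∘update′ (λ r′≡r → r≢r′ (sym r′≡r)) x₀ c) ⟨
      B (lookup x₁ w) (lookup x₁ r′) ⊛ cofactor facB x₁  ≡⟨ factorises facB x₁ ⟨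
      G x₁                                               ≡⟨ Gx₁≡0 ⟩
      0C                                                 ∎)
      where open ≡-Reasoning
    x₂ = x₁ [ w ]≔ not c
    B₂ = B (lookup x₂ w) (lookup x₂ r′)
    Gx₂≡0 : A (not c) c ⊛ cofactor facA x₀ ≡ 0C
    Gx₂≡0 = begin
      A (not c) c ⊛ cofactor facA x₀
        ≡⟨ BinaryFactor-at (λ r≡w → w≢r (sym r≡w)) (BinaryFactor-flip facA) x₀ c (not c) ⟨
      G x₂                       ≡⟨ factorises facB x₂ ⟩
      B₂ ⊛ cofactor facB x₂      ≡⟨ cong (B₂ ⊛_) (ignores₁ facB x₁ (not c)) ⟩
      B₂ ⊛ cofactor facB x₁      ≡⟨ cong (B₂ ⊛_) Hx₁≡0 ⟩
      B₂ ⊛ 0C                    ≡⟨ ⊛-zeroʳ B₂ ⟩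
      0C                         ∎
      where open ≡-Reasoning

  partner-∈-divisibleMerge-pair : ∀ {φ A B w r r′ s t} → BinaryFactor φ A w r → Pairing A →
    BinaryFactor (∂ s t φ) B w r′ → w ≢ r → r ≢ r′ → w ≢ s → w ≢ t →
    (x₀ : Input) → ∂ s t φ x₀ ≢ 0C → r ≡ s ⊎ r ≡ t
  partner-∈-divisibleMerge-pair {r = r} {s = s} {t} facA pairing facB w≢r r≢r′ w≢s w≢t x₀ ∂φx₀≢0
    with r ≟ s | r ≟ t
  ... | yes r≡s | _       = inj₁ r≡s
  ... | no _    | yes r≡t = inj₂ r≡t
  ... | no r≢s  | no r≢t  = ⊥-elim (r≢r′
    (partner-unique (∂-BinaryFactor w≢s w≢t r≢s r≢t facA) pairing facB w≢r x₀ ∂φx₀≢0))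

  BinaryFactor-proportional : ∀ {G A B w r} → w ≢ r → BinaryFactor G A w r → BinaryFactor G B w r →
    (x₀ : Input) → G x₀ ≢ 0C → Σ[ κ ∈ C ] ∀ c d → A c d ≡ B c d ⊛ κ
  BinaryFactor-proportional {G} {A} {B} w≢r facA facB x₀ Gx₀≢0 = H ⊛ K⁻¹ , A≡Bκ
    where
    K = cofactor facA x₀
    H = cofactor facB x₀
    inverse = ⊛-inverse K (cofactor-≢0 facA x₀ Gx₀≢0)
    K⁻¹ = proj₁ inverse
    A≡Bκ : ∀ c d → A c d ≡ B c d ⊛ (H ⊛ K⁻¹)
    A≡Bκ c d = begin
      A c d                ≡⟨ ⊛-identityʳ (A c d) ⟨
      A c d ⊛ 1C           ≡⟨ cong (A c d ⊛_) (proj₂ inverse) ⟨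
      A c d ⊛ (K ⊛ K⁻¹)    ≡⟨ ⊛-assoc (A c d) K K⁻¹ ⟨
      (A c d ⊛ K) ⊛ K⁻¹    ≡⟨ cong (_⊛ K⁻¹) (BinaryFactor-at w≢r facA x₀ c d) ⟨
      G _ ⊛ K⁻¹            ≡⟨ cong (_⊛ K⁻¹) (BinaryFactor-at w≢r facB x₀ c d) ⟩
      (B c d ⊛ H) ⊛ K⁻¹    ≡⟨ ⊛-assoc (B c d) H K⁻¹ ⟩
      B c d ⊛ (H ⊛ K⁻¹)    ∎
      where open ≡-Reasoning

module Products (F : OrderedField) {N : ℕ} where
  open ComplexField F
  open Signatures F {N}
  open BinaryFactor
  open Pairing

  Entry : Set
  Entry = Fin N × Fin N × C

  NonzeroWeight : Entry → Set
  NonzeroWeight (_ , _ , a) = a ≢ 0C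

  WellFormed : List Entry → Set
  WellFormed L = Distinct F (varsB F L) × All NonzeroWeight L

  arsBin-pairing : ∀ {a} → a ≢ 0C → Pairing (arsBin F a)
  arsBin-pairing {a} a≢0 = record
    { diagonal     = λ { false → refl ; true → refl }
    ; off-diagonal = λ { false → conj-≢0 a a≢0 ; true → a≢0 } }

  arsBin-0 : ∀ c d → arsBin F 0C c d ≡ 0C
  arsBin-0 false false = refl
  arsBin-0 false true  = refl
  arsBin-0 true  false = conj-0
  arsBin-0 true  true  = refl

  ∈∧∉⇒≢ : ∀ {z w : Fin N} {xs} → z ∈ xs → w ∉ xs → z ≢ w
  ∈∧∉⇒≢ z∈xs w∉xs z≡w = w∉xs (subst (_∈ _) z≡w z∈xs)

  prodB-local : ∀ L {x y : Input} → (∀ k → k ∈ varsB F L → lookup x k ≡ lookup y k) →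
    prodB F L x ≡ prodB F L y
  prodB-local []                agree = refl
  prodB-local ((p , q , a) ∷ L) agree = cong₂ _⊛_
    (cong₂ (arsBin F a) (agree p (here refl)) (agree q (there (here refl))))
    (prodB-local L (λ k k∈L → agree k (there (there k∈L))))

  prodB-ignores : ∀ L {w} → w ∉ varsB F L → Ignores (prodB F L) w
  prodB-ignores L w∉L x c = prodB-local L λ k k∈L →
    lookup∘update′ (∈∧∉⇒≢ k∈L w∉L) x c

  weights-≢0 : ∀ L → ¬ (∀ x → prodB F L x ≡ 0C) → All NonzeroWeight L
  weights-≢0 []                _      = []
  weights-≢0 ((p , q , a) ∷ L) prod≢0 = a≢0 ∷ weights-≢0 L rest≢0
    where
    a≢0 : a ≢ 0C
    a≢0 refl = prod≢0 λ x → trans (cong (_⊛ prodB F L x) (arsBin-0 (lookup x p) (lookup x q))) (⊛-zeroˡ _)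
    rest≢0 : ¬ (∀ x → prodB F L x ≡ 0C)
    rest≢0 L≡0 = prod≢0 λ x → trans (cong (_ ⊛_) (L≡0 x)) (⊛-zeroʳ _)

  prodB-nonzero-point : ∀ L → WellFormed L → Σ[ y ∈ Input ] prodB F L y ≢ 0C
  prodB-nonzero-point []                _                                = replicate N false , 1C≢0C
  prodB-nonzero-point ((p , q , a) ∷ L) (p∉ ∷ (q∉ ∷ distinct) , a≢0 ∷ as)
    with prodB-nonzero-point L (distinct , as)
  ... | y′ , Ly′≢0 = y , subst (_≢ 0C) (sym (cong₂ _⊛_ ars≡a Ly≡Ly′)) (⊛-≢0 a≢0 Ly′≢0)
    where
    y = (y′ [ p ]≔ false) [ q ]≔ true
    ars≡a : arsBin F a (lookup y p) (lookup y q) ≡ a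
    ars≡a = cong₂ (arsBin F a)
      (trans (lookup∘update′ (λ p≡q → p∉ (here p≡q)) (y′ [ p ]≔ false) true) (lookup∘update p y′ false))
      (lookup∘update q (y′ [ p ]≔ false) true)
    Ly≡Ly′ : prodB F L y ≡ prodB F L y′
    Ly≡Ly′ = trans (prodB-ignores L q∉ _ true) (prodB-ignores L (λ p∈L → p∉ (there p∈L)) y′ false)

  record Split (L : List Entry) (k : Fin N) : Set where
    field
      partner        : Fin N
      factor         : Bool → Bool → C
      rest           : List Entry
      k≢partner      : k ≢ partner
      partner∈       : partner ∈ varsB F L
      factor-pairing : Pairing factor
      rest-wf        : WellFormed rest
      k∉rest         : k ∉ varsB F rest
      partner∉rest   : partner ∉ varsB F rest
      rest⊆          : ∀ {z} → z ∈ varsB F rest → z ∈ varsB F L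
      ∈-split        : ∀ {z} → z ∈ varsB F L → z ≡ k ⊎ z ≡ partner ⊎ z ∈ varsB F rest
      splits         : ∀ x → prodB F L x ≡ factor (lookup x k) (lookup x partner) ⊛ prodB F rest x

    binaryFactor : BinaryFactor (prodB F L) factor k partner
    binaryFactor = record
      { cofactor = prodB F rest ; factorises = splits
      ; ignores₁ = prodB-ignores rest k∉rest ; ignores₂ = prodB-ignores rest partner∉rest }

    ∈-rest : ∀ {z} → z ∈ varsB F L → z ≢ k → z ≢ partner → z ∈ varsB F rest
    ∈-rest z∈L z≢k z≢p with ∈-split z∈L
    ... | inj₁ z≡k           = ⊥-elim (z≢k z≡k)
    ... | inj₂ (inj₁ z≡p)    = ⊥-elim (z≢p z≡p)
    ... | inj₂ (inj₂ z∈rest) = z∈rest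

  split : ∀ L k → WellFormed L → k ∈ varsB F L → Split L k
  split ((p , q , a) ∷ L) k (p∉ ∷ (q∉ ∷ distinct) , a≢0 ∷ as) (here refl) = record
    { partner = q ; factor = arsBin F a ; rest = L
    ; k≢partner = λ p≡q → p∉ (here p≡q) ; partner∈ = there (here refl)
    ; factor-pairing = arsBin-pairing a≢0 ; rest-wf = distinct , as
    ; k∉rest = λ p∈L → p∉ (there p∈L) ; partner∉rest = q∉
    ; rest⊆ = λ z∈L → there (there z∈L)
    ; ∈-split = λ { (here z≡p) → inj₁ z≡p ; (there (here z≡q)) → inj₂ (inj₁ z≡q)
                  ; (there (there z∈L)) → inj₂ (inj₂ z∈L) }
    ; splits = λ x → refl }
  split ((p , q , a) ∷ L) k (p∉ ∷ (q∉ ∷ distinct) , a≢0 ∷ as) (there (here refl)) = record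
    { partner = p ; factor = flip (arsBin F a) ; rest = L
    ; k≢partner = λ q≡p → p∉ (here (sym q≡p)) ; partner∈ = here refl
    ; factor-pairing = Pairing-flip (arsBin-pairing a≢0) ; rest-wf = distinct , as
    ; k∉rest = q∉ ; partner∉rest = λ p∈L → p∉ (there p∈L)
    ; rest⊆ = λ z∈L → there (there z∈L)
    ; ∈-split = λ { (here z≡p) → inj₂ (inj₁ z≡p) ; (there (here z≡q)) → inj₁ z≡q
                  ; (there (there z∈L)) → inj₂ (inj₂ z∈L) }
    ; splits = λ x → refl }
  split ((p , q , a) ∷ L) k (p∉ ∷ (q∉ ∷ distinct) , a≢0 ∷ as) (there (there k∈L)) = record
    { partner = S.partner ; factor = S.factor ; rest = (p , q , a) ∷ S.rest
    ; k≢partner = S.k≢partner ; partner∈ = there (there S.partner∈)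
    ; factor-pairing = S.factor-pairing
    ; rest-wf = ( (λ { (here p≡q) → p∉ (here p≡q) ; (there p∈rest) → p∉ (there (S.rest⊆ p∈rest)) })
                ∷ ((λ q∈rest → q∉ (S.rest⊆ q∈rest)) ∷ proj₁ S.rest-wf) )
              , a≢0 ∷ proj₂ S.rest-wf
    ; k∉rest = λ { (here k≡p) → p∉ (there (subst (_∈ varsB F L) k≡p k∈L))
                 ; (there (here k≡q)) → q∉ (subst (_∈ varsB F L) k≡q k∈L)
                 ; (there (there k∈rest)) → S.k∉rest k∈rest }
    ; partner∉rest = λ { (here r≡p) → p∉ (there (subst (_∈ varsB F L) r≡p S.partner∈))
                       ; (there (here r≡q)) → q∉ (subst (_∈ varsB F L) r≡q S.partner∈)
                       ; (there (there r∈rest)) → S.partner∉rest r∈rest }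
    ; rest⊆ = λ { (here z≡p) → here z≡p ; (there (here z≡q)) → there (here z≡q)
                ; (there (there z∈rest)) → there (there (S.rest⊆ z∈rest)) }
    ; ∈-split = λ { (here z≡p) → inj₂ (inj₂ (here z≡p)) ; (there (here z≡q)) → inj₂ (inj₂ (there (here z≡q)))
                  ; (there (there z∈L)) → map₂ (map₂ (there ∘ there)) (S.∈-split z∈L) }
    ; splits = λ x → trans (cong (_ ⊛_) (S.splits x)) (⊛-lcomm _ _ _) }
    where
    module S = Split (split L k (distinct , as) k∈L)

  ∂-split-paired-nonzero-point : ∀ {L s t} (S : Split L s) → s ≢ t → Split.partner S ≡ t →
    ¬ (∀ x → ∂ s t (prodB F L) x ≡ 0C) → Σ[ x ∈ Input ] ∂ s t (prodB F L) x ≢ 0C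
  ∂-split-paired-nonzero-point {L} {s} S s≢t refl ∂≢0 =
    y , subst (_≢ 0C) (sym (∂-BinaryFactor-on-pair s≢t binaryFactor y)) (⊛-≢0 σ≢0 Ky≢0)
    where
    open Split S
    σ≢0 : factor false true ⊕ factor true false ≢ 0C
    σ≢0 σ≡0 = ∂≢0 λ x → trans (∂-BinaryFactor-on-pair s≢t binaryFactor x)
                              (trans (cong (_⊛ prodB F rest x) σ≡0) (⊛-zeroˡ _))
    y = proj₁ (prodB-nonzero-point rest rest-wf)
    Ky≢0 = proj₂ (prodB-nonzero-point rest rest-wf)

  ∂-split-unpaired-nonzero-point : ∀ {L s t} (S : Split L s) → s ≢ t → t ∈ varsB F L → Split.partner S ≢ t →
    Σ[ x ∈ Input ] ∂ s t (prodB F L) x ≢ 0C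
  ∂-split-unpaired-nonzero-point {L} {s} {t} S s≢t t∈L p≢t = x , ∂Px≢0
    where
    open Split S renaming (partner to p; factor to A)
    t∈rest : t ∈ varsB F rest
    t∈rest = ∈-rest t∈L (λ t≡s → s≢t (sym t≡s)) (λ t≡p → p≢t (sym t≡p))
    open Split (split rest t rest-wf t∈rest) using ()
      renaming (partner to q; factor to A₂; rest to rest₂; k≢partner to t≢q; partner∈ to q∈rest;
                factor-pairing to A₂-pairing; rest-wf to rest₂-wf; k∉rest to t∉rest₂;
                partner∉rest to q∉rest₂; rest⊆ to rest₂⊆; splits to splits₂)
    y = proj₁ (prodB-nonzero-point rest₂ rest₂-wf)
    K₃y≢0 = proj₂ (prodB-nonzero-point rest₂ rest₂-wf)
    p≢q : p ≢ q
    p≢q p≡q = ∈∧∉⇒≢ q∈rest partner∉rest (sym p≡q)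
    p≢s : p ≢ s
    p≢s p≡s = k≢partner (sym p≡s)
    q≢s : q ≢ s
    q≢s = ∈∧∉⇒≢ q∈rest k∉rest
    -- With x_p = 1 and x_q = 0 only the term x_s = 0, x_t = 1 of the merging survives.
    x = (y [ p ]≔ true) [ q ]≔ false
    at : Bool → Bool → Input
    at a b = (x [ s ]≔ a) [ t ]≔ b
    K₃-at : ∀ a b → prodB F rest₂ (at a b) ≡ prodB F rest₂ y
    K₃-at a b = prodB-local rest₂ λ z z∈rest₂ →
      let z∈rest = rest₂⊆ z∈rest₂ in
      trans (lookup-update₂ x a b (∈∧∉⇒≢ z∈rest k∉rest) (∈∧∉⇒≢ z∈rest₂ t∉rest₂))
            (lookup-update₂ y true false (∈∧∉⇒≢ z∈rest partner∉rest) (∈∧∉⇒≢ z∈rest₂ q∉rest₂))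
    P-at : ∀ a b → prodB F L (at a b) ≡ A a true ⊛ (A₂ b false ⊛ prodB F rest₂ y)
    P-at a b = trans (splits (at a b)) (cong₂ _⊛_
      (cong₂ A (trans (lookup∘update′ s≢t (x [ s ]≔ a) b) (lookup∘update s x a))
               (trans (lookup-update₂ x a b p≢s p≢t)
                      (trans (lookup∘update′ p≢q (y [ p ]≔ true) false) (lookup∘update p y true))))
      (trans (splits₂ (at a b)) (cong₂ _⊛_
        (cong₂ A₂ (lookup∘update t (x [ s ]≔ a) b)
                  (trans (lookup-update₂ x a b q≢s (λ q≡t → t≢q (sym q≡t)))
                         (lookup∘update q (y [ p ]≔ true) false)))
        (K₃-at a b))))
    ∂Px≢0 : ∂ s t (prodB F L) x ≢ 0C
    ∂Px≢0 = subst (_≢ 0C) (sym ∂Px≡)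
      (⊛-≢0 (off-diagonal factor-pairing true) (⊛-≢0 (off-diagonal A₂-pairing false) K₃y≢0))
      where
      P-at-true-false : prodB F L (at true false) ≡ 0C
      P-at-true-false = trans (P-at true false)
        (trans (cong (_⊛ (A₂ false false ⊛ prodB F rest₂ y)) (diagonal factor-pairing true)) (⊛-zeroˡ _))
      ∂Px≡ : ∂ s t (prodB F L) x ≡ A false true ⊛ (A₂ true false ⊛ prodB F rest₂ y)
      ∂Px≡ = trans (cong₂ _⊕_ (P-at false true) P-at-true-false) (⊕-identityʳ _)

  ∂-prodB-nonzero-point : ∀ L {s t} → WellFormed L → s ≢ t → s ∈ varsB F L → t ∈ varsB F L →
    ¬ (∀ x → ∂ s t (prodB F L) x ≡ 0C) → Σ[ x ∈ Input ] ∂ s t (prodB F L) x ≢ 0C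
  ∂-prodB-nonzero-point L {s} {t} wf s≢t s∈L t∈L ∂≢0 with split L s wf s∈L
  ... | S with Split.partner S ≟ t
  ...   | yes p≡t = ∂-split-paired-nonzero-point S s≢t p≡t ∂≢0
  ...   | no  p≢t = ∂-split-unpaired-nonzero-point S s≢t t∈L p≢t

x∧[y∧¬x]≡false : ∀ x y → x ∧ (y ∧ not x) ≡ false
x∧[y∧¬x]≡false false y     = refl
x∧[y∧¬x]≡false true  false = refl
x∧[y∧¬x]≡false true  true  = refl

y≡x∨[y∧¬x] : ∀ {x y} → (x ≡ true → y ≡ true) → y ≡ x ∨ (y ∧ not x)
y≡x∨[y∧¬x] {false} {y}     _   = sym (∧-identityʳ y)
y≡x∨[y∧¬x] {true}  {false} x⇒y = x⇒y refl
y≡x∨[y∧¬x] {true}  {true}  _   = refl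

false≢true : false ≢ true
false≢true ()

module Scopes (F : OrderedField) {N : ℕ} where
  open ComplexField F
  open Signatures F {N}

  scope-merge : ∀ (g : Sig F N) {i j k} → scope g k ≡ true → k ≢ i → k ≢ j → scope (merge F i j g) k ≡ true
  scope-merge g {i} {j} {k} gk k≢i k≢j with k ≟ i | k ≟ j
  ... | yes k≡i | _       = ⊥-elim (k≢i k≡i)
  ... | no _    | yes k≡j = ⊥-elim (k≢j k≡j)
  ... | no _    | no _    rewrite gk = refl

  scope-binSig₁ : ∀ u v b → scope (binSig F {N} u v b) u ≡ true
  scope-binSig₁ u v b with u ≟ u
  ... | yes _   = refl
  ... | no u≢u = ⊥-elim (u≢u refl)

  scope-binSig₂ : ∀ u v b → scope (binSig F {N} u v b) v ≡ true
  scope-binSig₂ u v b with v ≟ u | v ≟ v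
  ... | yes _ | _       = refl
  ... | no _  | yes _   = refl
  ... | no _  | no v≢v = ⊥-elim (v≢v refl)

  scope-binSig⁻ : ∀ {u v b k} → scope (binSig F {N} u v b) k ≡ true → k ≡ u ⊎ k ≡ v
  scope-binSig⁻ {u} {v} {b} {k} bk with k ≟ u | k ≟ v
  ... | yes k≡u | _       = inj₁ k≡u
  ... | no _    | yes k≡v = inj₂ k≡v
  ... | no _    | no _    = ⊥-elim (false≢true bk)

  scope-binSig-∉ : ∀ {u v b k} → k ≢ u → k ≢ v → scope (binSig F {N} u v b) k ≡ false
  scope-binSig-∉ {u} {v} {b} {k} k≢u k≢v with scope (binSig F u v b) k in bk
  ... | false = refl
  ... | true  = ⊥-elim ([ k≢u , k≢v ]′ (scope-binSig⁻ {b = b} bk))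

  divides⇒BinaryFactor : ∀ {g : Sig F N} {u v b k} → scope g k ≡ true → k ≢ u → k ≢ v →
    Divides F (binSig F u v b) g → BinaryFactor (val g) b u v
  divides⇒BinaryFactor {g} {u} {v} {b} {k} gk k≢u k≢v (_ , inj₁ (h , h-local , disjoint , _ , _ , g≡bh)) =
    record { cofactor = val h ; factorises = g≡bh ; ignores₁ = ignores (scope-binSig₁ u v b)
           ; ignores₂ = ignores (scope-binSig₂ u v b) }
    where
    ignores : ∀ {w} → scope (binSig F u v b) w ≡ true → Ignores (val h) w
    ignores {w} bw x c = h-local (x [ w ]≔ c) x λ z hz →
      lookup∘update′ (λ z≡w → false≢true (trans (sym (disjoint w))
                                                  (cong₂ _∧_ bw (subst (λ y → scope h y ≡ true) z≡w hz)))) x c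
  divides⇒BinaryFactor {g} {u} {v} {b} {k} gk k≢u k≢v (_ , inj₂ (_ , g≡b , _)) =
    ⊥-elim (false≢true (trans (sym (scope-binSig-∉ {b = b} k≢u k≢v)) (trans (sym (g≡b k)) gk)))

  BinaryFactor⇒divides : ∀ (g : Sig F N) {u v b k} (h : Input → C) → NotZero F (binSig F u v b) →
    scope g u ≡ true → scope g v ≡ true → scope g k ≡ true → k ≢ u → k ≢ v →
    (∀ x y → (∀ z → scope g z ≡ true → z ≢ u → z ≢ v → lookup x z ≡ lookup y z) → h x ≡ h y) →
    (∀ x → val g x ≡ b (lookup x u) (lookup x v) ⊛ h x) →
    Divides F (binSig F u v b) g
  BinaryFactor⇒divides g {u} {v} {b} {k} h b≢0 gu gv gk k≢u k≢v h-local g≡bh =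
    b≢0 , inj₁ (h′ , h′-local , disjoint , covers , (k , h′-scope gk k≢u k≢v) , g≡bh)
    where
    bin = binSig F u v b
    h′ : Sig F N
    h′ = record { scope = λ z → scope g z ∧ not (scope bin z) ; val = h }
    h′-scope : ∀ {z} → scope g z ≡ true → z ≢ u → z ≢ v → scope h′ z ≡ true
    h′-scope {z} gz z≢u z≢v rewrite gz | scope-binSig-∉ {b = b} z≢u z≢v = refl
    h′-local : Local F h′
    h′-local x y agree = h-local x y λ z gz z≢u z≢v → agree z (h′-scope gz z≢u z≢v)
    disjoint : ∀ z → scope bin z ∧ scope h′ z ≡ false
    disjoint z = x∧[y∧¬x]≡false (scope bin z) (scope g z)
    covers : ∀ z → scope g z ≡ scope bin z ∨ scope h′ z
    covers z = y≡x∨[y∧¬x] λ bz →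
      [ (λ z≡u → subst (λ y → scope g y ≡ true) (sym z≡u) gu)
      , (λ z≡v → subst (λ y → scope g y ≡ true) (sym z≡v) gv) ]′ (scope-binSig⁻ {b = b} bz)

pair-unique : ∀ {N} {p q s t s′ t′ : Fin N} → p ≢ q → p ≡ s ⊎ p ≡ t → q ≡ s ⊎ q ≡ t →
  p ≡ s′ ⊎ p ≡ t′ → q ≡ s′ ⊎ q ≡ t′ → SamePair s t s′ t′
pair-unique p≢q (inj₁ refl) (inj₁ refl) _           _           = ⊥-elim (p≢q refl)
pair-unique p≢q (inj₂ refl) (inj₂ refl) _           _           = ⊥-elim (p≢q refl)
pair-unique p≢q _           _           (inj₁ refl) (inj₁ refl) = ⊥-elim (p≢q refl)
pair-unique p≢q _           _           (inj₂ refl) (inj₂ refl) = ⊥-elim (p≢q refl)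
pair-unique p≢q (inj₁ refl) (inj₂ refl) (inj₁ refl) (inj₂ refl) = inj₁ (refl , refl)
pair-unique p≢q (inj₁ refl) (inj₂ refl) (inj₂ refl) (inj₁ refl) = inj₂ (refl , refl)
pair-unique p≢q (inj₂ refl) (inj₁ refl) (inj₁ refl) (inj₂ refl) = inj₂ (refl , refl)
pair-unique p≢q (inj₂ refl) (inj₁ refl) (inj₂ refl) (inj₁ refl) = inj₁ (refl , refl)

module MergedProduct (F : OrderedField) {N : ℕ} (f : Vec Bool N → ℂ F) (f∈∫B : IntB≢0 F (full F f))
  {i j u v : Fin N} (i≢j : i ≢ j) (u≢v : u ≢ v) (i∉uv : NotIn2 i u v) (j∉uv : NotIn2 j u v)
  (b : Bool → Bool → ℂ F) where

  open ComplexField F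
  open Signatures F {N}
  open Products F {N}
  open Scopes F {N}
  open BinaryFactor
  open Split

  g : Sig F N
  g = merge F i j (full F f)

  L : List Entry
  L = proj₁ (proj₁ (f∈∫B i j i≢j))

  L-scope : ∀ k → (scope g k ≡ true → k ∈ varsB F L) × (k ∈ varsB F L → scope g k ≡ true)
  L-scope = proj₁ (proj₂ (proj₂ (proj₂ (proj₁ (f∈∫B i j i≢j)))))

  g≗prodB : val g ≗ prodB F L
  g≗prodB = proj₂ (proj₂ (proj₂ (proj₂ (proj₁ (f∈∫B i j i≢j)))))

  g≢0 : NotZero F g
  g≢0 = proj₂ (f∈∫B i j i≢j)

  wf : WellFormed L
  wf = proj₁ (proj₂ (proj₂ (proj₁ (f∈∫B i j i≢j))))
     , weights-≢0 L (λ L≡0 → g≢0 λ x → trans (g≗prodB x) (L≡0 x))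

  scope-g : ∀ {k} → k ≢ i → k ≢ j → scope g k ≡ true
  scope-g = scope-merge (full F f) refl

  ∈L : ∀ {k} → k ≢ i → k ≢ j → k ∈ varsB F L
  ∈L k≢i k≢j = proj₁ (L-scope _) (scope-g k≢i k≢j)

  u≢i : u ≢ i
  u≢i u≡i = proj₁ i∉uv (sym u≡i)
  u≢j : u ≢ j
  u≢j u≡j = proj₁ j∉uv (sym u≡j)
  v≢i : v ≢ i
  v≢i v≡i = proj₂ i∉uv (sym v≡i)
  v≢j : v ≢ j
  v≢j v≡j = proj₂ j∉uv (sym v≡j)

  x₀ : Input
  x₀ = proj₁ (prodB-nonzero-point L wf)

  gx₀≢0 : val g x₀ ≢ 0C
  gx₀≢0 = subst (_≢ 0C) (sym (g≗prodB x₀)) (proj₂ (prodB-nonzero-point L wf))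

  Su : Split L u
  Su = split L u wf (∈L u≢i u≢j)

  Sv : Split L v
  Sv = split L v wf (∈L v≢i v≢j)

  factor-u : BinaryFactor (val g) (factor Su) u (partner Su)
  factor-u = BinaryFactor-resp-≗ g≗prodB (binaryFactor Su)

  factor-v : BinaryFactor (val g) (factor Sv) v (partner Sv)
  factor-v = BinaryFactor-resp-≗ g≗prodB (binaryFactor Sv)

  record DivisibleMerge (a c : Fin N) : Set where
    field
      u∉ : NotIn2 u a c
      v∉ : NotIn2 v a c
      i∉ : NotIn2 i a c
      j∉ : NotIn2 j a c
      binSig≢0 : NotZero F (binSig F u v b)
      ∂-factor : BinaryFactor (∂ a c (val g)) b u v
      point    : Input
      point-≢0 : ∂ a c (val g) point ≢ 0C

  divisibleMerge : ∀ {a c} → a ≢ c → NotIn2 u a c → NotIn2 v a c → NotIn2 i a c → NotIn2 j a c →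
    Divides F (binSig F u v b) (merge F a c (full F f)) → NotZero F (merge F a c g) → DivisibleMerge a c
  divisibleMerge {a} {c} a≢c u∉ v∉ i∉@(i≢a , i≢c) j∉@(j≢a , j≢c) b∣∂f ∂g≢0 = record
    { u∉ = u∉ ; v∉ = v∉ ; i∉ = i∉ ; j∉ = j∉
    ; binSig≢0 = proj₁ b∣∂f
    ; ∂-factor = BinaryFactor-resp-≗ (∂-comm f i≢a i≢c j≢a j≢c) (∂-BinaryFactor u≢i u≢j v≢i v≢j
        (divides⇒BinaryFactor (scope-merge (full F f) refl i≢a i≢c) (proj₁ i∉uv) (proj₂ i∉uv) b∣∂f))
    ; point = proj₁ point
    ; point-≢0 = subst (_≢ 0C) (sym (∂-cong a c g≗prodB (proj₁ point))) (proj₂ point) }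
    where
    point : Σ[ x ∈ Input ] ∂ a c (prodB F L) x ≢ 0C
    point = ∂-prodB-nonzero-point L wf a≢c (∈L (λ a≡i → i≢a (sym a≡i)) (λ a≡j → j≢a (sym a≡j)))
      (∈L (λ c≡i → i≢c (sym c≡i)) (λ c≡j → j≢c (sym c≡j)))
      (λ ∂≡0 → ∂g≢0 λ x → trans (∂-cong a c g≗prodB x) (∂≡0 x))

  open DivisibleMerge

  divides-if-paired : ∀ {a c} → partner Su ≡ v → DivisibleMerge a c → Divides F (binSig F u v b) g
  divides-if-paired {a} p≡v M =
    BinaryFactor⇒divides g {b = b} {k = a} h (binSig≢0 M) (scope-g u≢i u≢j) (scope-g v≢i v≢j)
      (scope-g (λ a≡i → proj₁ (i∉ M) (sym a≡i)) (λ a≡j → proj₁ (j∉ M) (sym a≡j)))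
      (λ a≡u → proj₁ (u∉ M) (sym a≡u)) (λ a≡v → proj₁ (v∉ M) (sym a≡v)) h-local g≡bh
    where
    A = factor Su
    factor-uv : BinaryFactor (val g) A u v
    factor-uv = subst (BinaryFactor (val g) A u) p≡v factor-u
    proportional = BinaryFactor-proportional u≢v
      (∂-BinaryFactor (proj₁ (u∉ M)) (proj₂ (u∉ M)) (proj₁ (v∉ M)) (proj₂ (v∉ M)) factor-uv)
      (∂-factor M) (point M) (point-≢0 M)
    κ = proj₁ proportional
    h : Input → C
    h x = κ ⊛ prodB F (rest Su) x
    h-local : ∀ x y → (∀ z → scope g z ≡ true → z ≢ u → z ≢ v → lookup x z ≡ lookup y z) → h x ≡ h y
    h-local x y agree = cong (κ ⊛_) (prodB-local (rest Su) λ z z∈rest →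
      agree z (proj₂ (L-scope z) (rest⊆ Su z∈rest)) (∈∧∉⇒≢ z∈rest (k∉rest Su))
            (∈∧∉⇒≢ z∈rest (subst (_∉ varsB F (rest Su)) p≡v (partner∉rest Su))))
    g≡bh : ∀ x → val g x ≡ b (lookup x u) (lookup x v) ⊛ h x
    g≡bh x = begin
      val g x                                                 ≡⟨ g≗prodB x ⟩
      prodB F L x                                             ≡⟨ splits Su x ⟩
      A (lookup x u) (lookup x (partner Su)) ⊛ prodB F (rest Su) x
        ≡⟨ cong (λ w → A (lookup x u) (lookup x w) ⊛ prodB F (rest Su) x) p≡v ⟩
      A (lookup x u) (lookup x v) ⊛ prodB F (rest Su) x
        ≡⟨ cong (_⊛ prodB F (rest Su) x) (proj₂ proportional _ _) ⟩
      (b (lookup x u) (lookup x v) ⊛ κ) ⊛ prodB F (rest Su) x ≡⟨ ⊛-assoc _ κ _ ⟩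
      b (lookup x u) (lookup x v) ⊛ h x                       ∎
      where open ≡-Reasoning

  module Unpaired (p≢v : partner Su ≢ v) where

    partner-v≢u : partner Sv ≢ u
    partner-v≢u q≡u = p≢v (partner-unique factor-u (factor-pairing Su)
      (subst (λ w → BinaryFactor (val g) (flip (factor Sv)) w v) q≡u (BinaryFactor-flip factor-v))
      (k≢partner Su) x₀ gx₀≢0)

    partners-distinct : partner Su ≢ partner Sv
    partners-distinct p≡q = u≢v (partner-unique
      (BinaryFactor-flip factor-u) (Pairing-flip (factor-pairing Su))
      (subst (λ w → BinaryFactor (val g) (flip (factor Sv)) w v) (sym p≡q) (BinaryFactor-flip factor-v))
      (λ p≡u → k≢partner Su (sym p≡u)) x₀ gx₀≢0)

    partner-u∈ : ∀ {a c} → DivisibleMerge a c → partner Su ≡ a ⊎ partner Su ≡ c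
    partner-u∈ M = partner-∈-divisibleMerge-pair factor-u (factor-pairing Su) (∂-factor M)
      (k≢partner Su) p≢v (proj₁ (u∉ M)) (proj₂ (u∉ M)) (point M) (point-≢0 M)

    partner-v∈ : ∀ {a c} → DivisibleMerge a c → partner Sv ≡ a ⊎ partner Sv ≡ c
    partner-v∈ M = partner-∈-divisibleMerge-pair factor-v (factor-pairing Sv) (BinaryFactor-flip (∂-factor M))
      (k≢partner Sv) partner-v≢u (proj₁ (v∉ M)) (proj₂ (v∉ M)) (point M) (point-≢0 M)

  binSig-divides-merge : ∀ {s t s′ t′} → ¬ SamePair s t s′ t′ → DivisibleMerge s t → DivisibleMerge s′ t′ →
    Divides F (binSig F u v b) g
  binSig-divides-merge ¬same M M′ with partner Su ≟ v
  ... | yes p≡v = divides-if-paired p≡v M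
  ... | no  p≢v = ⊥-elim (¬same (pair-unique partners-distinct
                    (partner-u∈ M) (partner-v∈ M) (partner-u∈ M′) (partner-v∈ M′)))
    where open Unpaired p≢v

lemma4p3 : (F : OrderedField) (n : ℕ) → 4 ≤ n →
    (f : Vec Bool (n +ℕ n) → ℂ F) →
    EO F n f → ARS F f → IntB≢0 F (full F f) →
    (s t s' t' u v : Fin (n +ℕ n)) →
    s ≢ t → s' ≢ t' → ¬ SamePair s t s' t' →
    u ≢ v →
    NotIn2 u s t → NotIn2 u s' t' → NotIn2 v s t → NotIn2 v s' t' →
    (b : Bool → Bool → ℂ F) →
    Divides F (binSig F u v b) (merge F s t (full F f)) →
    Divides F (binSig F u v b) (merge F s' t' (full F f)) →
    (i j : Fin (n +ℕ n)) → i ≢ j →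
    NotIn2 i u v → NotIn2 i s t → NotIn2 i s' t' →
    NotIn2 j u v → NotIn2 j s t → NotIn2 j s' t' →
    NotZero F (merge F s t (merge F i j (full F f))) →
    NotZero F (merge F s' t' (merge F i j (full F f))) →
    Divides F (binSig F u v b) (merge F i j (full F f))
lemma4p3 F n _ f _ _ f∈∫B s t s′ t′ u v s≢t s′≢t′ ¬same u≢v u∉st u∉s′t′ v∉st v∉s′t′ b b∣∂st b∣∂s′t′
         i j i≢j i∉uv i∉st i∉s′t′ j∉uv j∉st j∉s′t′ ∂st≢0 ∂s′t′≢0 =
  binSig-divides-merge ¬same (divisibleMerge s≢t u∉st v∉st i∉st j∉st b∣∂st ∂st≢0)
                   (divisibleMerge s′≢t′ u∉s′t′ v∉s′t′ i∉s′t′ j∉s′t′ b∣∂s′t′ ∂s′t′≢0)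
  where open MergedProduct F f f∈∫B i≢j u≢v i∉uv j∉uv b
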